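{- For every $p\in\mathbb{Z}$ and every integer $n\ge 0$, $$\beta_{n,\lambda}^{(p)}(x)=\sum_{k=0}^{n}\frac{(-\lambda)^{k}(1)_{k+1,1/\lambda}}{(k+1)^{p}\,k!}\sum_{l=0}^{k}\binom{k}{l}(-1)^{l}(x-l)_{n,-\lambda}.$$
   Context: Let $\lambda$ be a nonzero real number. For $\mu\in\mathbb{R}$, $(x)_{0,\mu}=1$, $(x)_{n,\mu}=x(x-\mu)\cdots(x-(n-1)\mu)$ for $n\ge1$, and $e_\mu^x(t)=\sum_{k\ge0}(x)_{k,\mu}t^k/k!$ (formal power series in $t$), $e_\mu(t)=e_\mu^1(t)$. For $k\in\mathbb{Z}$, the degenerate polylogarithm is $\mathrm{Li}_{k,\lambda}(y)=\sum_{n\ge1}\frac{(-\lambda)^{n-1}(1)_{n,1/\lambda}}{(n-1)!\,n^k}y^n$. The degenerate poly-Bernoulli polynomials of index $k$ are defined by $\frac{\mathrm{Li}_{k,\lambda}(1-e_\lambda(-t))}{1-e_\lambda(-t)}e_\lambda^{ -x}(-t)=\sum_{n\ge0}\beta^{(k)}_{n,\lambda}(x)\frac{t^n}{n!}$. -}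

module Defs where

open import Level using (Level; _⊔_) renaming (suc to lsuc)
open import Algebra.Bundles using (CommutativeRing)
open import Data.Nat as ℕ using (ℕ; zero; suc; _∸_)
open import Data.Nat using (_!)
open import Data.Nat.Combinatorics using (_C_)
open import Data.Integer using (ℤ; +_; -[1+_])
open import Relation.Nullary using (¬_)

-- The standard library has no (non-Heyting) Field bundle, so we give one:
-- a commutative ring with an inverse operation that is a right inverse on
-- nonzero elements, in which n·1 ≠ 0 for all n ≥ 1.
-- the canonical map ℕ → R, n ↦ n·1
ι : ∀ {c ℓ} (R : CommutativeRing c ℓ) → ℕ → CommutativeRing.Carrier R
ι R zero = CommutativeRing.0# R
ι R (suc n) = CommutativeRing._+_ R (CommutativeRing.1# R) (ι R n)

record CharZeroField (c ℓ : Level) : Set (lsuc (c ⊔ ℓ)) where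
  field
    commRing : CommutativeRing c ℓ
  open CommutativeRing commRing
  field
    _⁻¹ : Carrier → Carrier
    inverseʳ : ∀ x → ¬ (x ≈ 0#) → (x * (x ⁻¹)) ≈ 1#
    charZero : ∀ n → ¬ (ι commRing (suc n) ≈ 0#)

module WithField {c ℓ} (F : CharZeroField c ℓ) where
  open CharZeroField F using (commRing; _⁻¹) public
  open CommutativeRing commRing public hiding (zero)

  ιF : ℕ → Carrier
  ιF = ι commRing

  pow : Carrier → ℕ → Carrier
  pow x zero = 1#
  pow x (suc n) = pow x n * x

  powℤ : Carrier → ℤ → Carrier
  powℤ x (+ n) = pow x n
  powℤ x -[1+ n ] = (pow x (suc n)) ⁻¹

  sumTo : ℕ → (ℕ → Carrier) → Carrier
  sumTo zero f = f 0
  sumTo (suc n) f = sumTo n f + f (suc n)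

  fall : Carrier → Carrier → ℕ → Carrier
  fall x μ zero = 1#
  fall x μ (suc n) = fall x μ n * (x - (ιF n * μ))

  Series : Set c
  Series = ℕ → Carrier

  mulS : Series → Series → Series
  mulS f g n = sumTo n (λ i → f i * g (n ∸ i))

  powS : Series → ℕ → Series
  powS g zero zero = 1#
  powS g zero (suc n) = 0#
  powS g (suc m) = mulS (powS g m) g

  -- composition f(g(t)) for g with zero constant term
  -- (g^m has no terms below degree m, so the sum over m ≤ n is exact)
  compS : Series → Series → Series
  compS f g n = sumTo n (λ m → f m * powS g m n)

  eS : Carrier → Carrier → Series
  eS μ x k = fall x μ k * (ιF (k !) ⁻¹)

  negArg : Series → Series
  negArg f k = pow (- 1#) k * f k

  -- the series y(t) = 1 - e_λ(-t)   (e_λ(t) = e_λ^1(t))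
  yS : Carrier → Series
  yS lam zero = 1# - negArg (eS lam 1#) zero
  yS lam (suc k) = - negArg (eS lam 1#) (suc k)

  -- Li_{k,λ}(y)/y as a power series in y:
  -- coefficient of y^j is the coefficient of y^(j+1) in Li_{k,λ}(y), i.e.
  -- (-λ)^j (1)_{j+1,1/λ} / (j! (j+1)^k)
  liOverY : ℤ → Carrier → Series
  liOverY k lam j =
    pow (- lam) j * fall 1# (lam ⁻¹) (suc j) * (ιF (j !) ⁻¹) * (powℤ (ιF (suc j)) k ⁻¹)

  -- degenerate poly-Bernoulli polynomial β^{(k)}_{n,λ}(x):
  -- n! times the t^n coefficient of  Li_{k,λ}(1-e_λ(-t))/(1-e_λ(-t)) · e_λ^{-x}(-t)
  β : ℤ → ℕ → Carrier → Carrier → Carrier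
  β k n lam x =
    ιF (n !) * mulS (compS (liOverY k lam) (yS lam)) (negArg (eS lam (- x))) n

  theorem8-rhs : ℤ → ℕ → Carrier → Carrier → Carrier
  theorem8-rhs p n lam x =
    sumTo n (λ k →
      (pow (- lam) k * fall 1# (lam ⁻¹) (suc k)) * ((powℤ (ιF (suc k)) p * ιF (k !)) ⁻¹)
      * sumTo k (λ l → ιF (k C l) * pow (- 1#) l * fall (x - ιF l) (- lam) n))

-- Write μ = -λ and E_a for the series e_μ^a(t). The reflection
-- (-1)^k (-a)_{k,λ} = (a)_{k,-λ} turns e_λ^{-x}(-t) into E_x and 1 - e_λ(-t)
-- into E_0 - E_{-1}, and the Vandermonde identity for (·)_{n,μ} gives
-- E_a E_b = E_{a+b}. Hence (1 - e_λ(-t))^k E_x = Σ_l C(k,l) (-1)^l E_{x-l},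
-- whose t^n coefficient is Σ_l C(k,l) (-1)^l (x-l)_{n,-λ} / n!. As 1 - e_λ(-t)
-- has no constant term, only the terms k ≤ n of Li_{p,λ}(y)/y contribute to t^n.
module Submission where

open import Defs
open import Level using (0ℓ)
open import Algebra.Bundles using (CommutativeRing; RawRing)
open import Algebra.Solver.Ring.AlmostCommutativeRing
  using (fromCommutativeRing; _-Raw-AlmostCommutative⟶_; Induced-equivalence)
open import Data.Maybe using (just; nothing)
open import Data.Product using (_×_; _,_)
open import Data.Nat as ℕ using (ℕ; zero; suc; _∸_; _≤_; _<_; s≤s; z≤n; _!)
open import Data.Nat.DivMod using (m/n*n≡m)
open import Data.Nat.Combinatorics using (_C_; nCk≡n!/k![n-k]!; k>n⇒nCk≡0; nCk+nC[k+1]≡[n+1]C[k+1]; k![n∸k]!∣n!)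
open import Data.Nat.Properties as ℕₚ using (_!≢0; _!*_!≢0)
open import Data.Integer using (ℤ; +_; -[1+_])
open import Relation.Binary.Definitions using (WeaklyDecidable)
open import Relation.Binary.PropositionalEquality as ≡ using (_≡_)
open import Relation.Nullary using (¬_; yes; no)

module IntegerCoefficientSolver {c ℓ} (R : CommutativeRing c ℓ) where
  open CommutativeRing R
  open import Relation.Binary.Reasoning.Setoid setoid
  open import Algebra.Properties.CommutativeSemigroup +-commutativeSemigroup using (interchange)
  open import Algebra.Properties.Ring ring
    using (x[y-z]≈xy-xz; [y-z]x≈yx-zx; -‿+-comm; ⁻¹-anti-homo‿-; -0#≈0#)
  open import Algebra.Properties.Semiring.Mult semiring using (×-homo-+; ×1-homo-*) renaming (_×_ to _·_)

  ι≈·1# : ∀ n → ι R n ≈ n · 1#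
  ι≈·1# zero = refl
  ι≈·1# (suc n) = +-congˡ (ι≈·1# n)

  ι-+ : ∀ m n → ι R (m ℕ.+ n) ≈ ι R m + ι R n
  ι-+ m n = begin
    ι R (m ℕ.+ n)         ≈⟨ ι≈·1# (m ℕ.+ n) ⟩
    (m ℕ.+ n) · 1#        ≈⟨ ×-homo-+ 1# m n ⟩
    m · 1# + n · 1#       ≈⟨ +-cong (ι≈·1# m) (ι≈·1# n) ⟨
    ι R m + ι R n         ∎

  ι-* : ∀ m n → ι R (m ℕ.* n) ≈ ι R m * ι R n
  ι-* m n = begin
    ι R (m ℕ.* n)         ≈⟨ ι≈·1# (m ℕ.* n) ⟩
    (m ℕ.* n) · 1#        ≈⟨ ×1-homo-* m n ⟩
    (m · 1#) * (n · 1#)   ≈⟨ *-cong (ι≈·1# m) (ι≈·1# n) ⟨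
    ι R m * ι R n         ∎

  [p+r]-[q+s]≈[p-q]+[r-s] : ∀ p q r s → (p + r) - (q + s) ≈ (p - q) + (r - s)
  [p+r]-[q+s]≈[p-q]+[r-s] p q r s =
    trans (+-congˡ (sym (-‿+-comm q s))) (interchange p r (- q) (- s))

  [pr+qs]-[ps+qr]≈[p-q][r-s] : ∀ p q r s → (p * r + q * s) - (p * s + q * r) ≈ (p - q) * (r - s)
  [pr+qs]-[ps+qr]≈[p-q][r-s] p q r s = sym (begin
    (p - q) * (r - s)                     ≈⟨ [y-z]x≈yx-zx (r - s) p q ⟩
    p * (r - s) - q * (r - s)             ≈⟨ +-cong (x[y-z]≈xy-xz p r s) (-‿cong (x[y-z]≈xy-xz q r s)) ⟩
    (p * r - p * s) - (q * r - q * s)     ≈⟨ +-congˡ (⁻¹-anti-homo‿- (q * r) (q * s)) ⟩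
    (p * r - p * s) + (q * s - q * r)     ≈⟨ interchange (p * r) (- (p * s)) (q * s) (- (q * r)) ⟩
    (p * r + q * s) + (- (p * s) - q * r) ≈⟨ +-congˡ (-‿+-comm (p * s) (q * r)) ⟩
    (p * r + q * s) - (p * s + q * r)     ∎)

  p+s≈r+q⇒p-q≈r-s : ∀ {p q r s} → p + s ≈ r + q → p - q ≈ r - s
  p+s≈r+q⇒p-q≈r-s {p} {q} {r} {s} eq = begin
    p - q               ≈⟨ +-identityʳ (p - q) ⟨
    (p - q) + 0#        ≈⟨ +-congˡ (-‿inverseʳ s) ⟨
    (p - q) + (s - s)   ≈⟨ [p+r]-[q+s]≈[p-q]+[r-s] p q s s ⟨
    (p + s) - (q + s)   ≈⟨ +-cong eq (-‿cong (+-comm q s)) ⟩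
    (r + q) - (s + q)   ≈⟨ [p+r]-[q+s]≈[p-q]+[r-s] r s q q ⟩
    (r - s) + (q - q)   ≈⟨ +-congˡ (-‿inverseʳ q) ⟩
    (r - s) + 0#        ≈⟨ +-identityʳ (r - s) ⟩
    r - s               ∎

  -- ℤ presented as pairs (a , b) standing for a - b, so that the coefficient
  -- arithmetic computes by ℕ-recursion
  differences : RawRing 0ℓ 0ℓ
  differences = record
    { Carrier = ℕ × ℕ ; _≈_ = _≡_
    ; _+_ = λ { (a , b) (c , d) → (a ℕ.+ c , b ℕ.+ d) }
    ; _*_ = λ { (a , b) (c , d) → (a ℕ.* c ℕ.+ b ℕ.* d , a ℕ.* d ℕ.+ b ℕ.* c) }
    ; -_ = λ { (a , b) → (b , a) }
    ; 0# = (0 , 0) ; 1# = (1 , 0) }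

  difference : ℕ × ℕ → Carrier
  difference (a , b) = ι R a - ι R b

  differences⟶R : differences -Raw-AlmostCommutative⟶ fromCommutativeRing R
  differences⟶R = record
    { ⟦_⟧ = difference
    ; +-homo = λ { (a , b) (c , d) →
        trans (+-cong (ι-+ a c) (-‿cong (ι-+ b d))) ([p+r]-[q+s]≈[p-q]+[r-s] _ _ _ _) }
    ; *-homo = λ { (a , b) (c , d) →
        trans (+-cong (trans (ι-+ (a ℕ.* c) (b ℕ.* d)) (+-cong (ι-* a c) (ι-* b d)))
                      (-‿cong (trans (ι-+ (a ℕ.* d) (b ℕ.* c)) (+-cong (ι-* a d) (ι-* b c)))))
              ([pr+qs]-[ps+qr]≈[p-q][r-s] _ _ _ _) }
    ; -‿homo = λ { (a , b) → sym (⁻¹-anti-homo‿- (ι R a) (ι R b)) }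
    ; 0-homo = -‿inverseʳ 0#
    ; 1-homo = trans (+-congˡ -0#≈0#) (trans (+-identityʳ _) (+-identityʳ 1#))
    }

  weaklyDecidable : WeaklyDecidable (Induced-equivalence differences⟶R)
  weaklyDecidable (a , b) (c , d) with a ℕ.+ d ℕₚ.≟ c ℕ.+ b
  ... | yes eq = just (p+s≈r+q⇒p-q≈r-s (trans (sym (ι-+ a d)) (trans (reflexive (≡.cong (ι R) eq)) (ι-+ c b))))
  ... | no _ = nothing

  open import Algebra.Solver.Ring differences (fromCommutativeRing R) differences⟶R weaklyDecidable public

nCk*[k!*[n∸k]!]≡n! : ∀ {n k} → k ≤ n → (n C k) ℕ.* (k ! ℕ.* (n ∸ k) !) ≡ n !
nCk*[k!*[n∸k]!]≡n! {n} {k} k≤n =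
  ≡.trans (≡.cong (ℕ._* (k ! ℕ.* (n ∸ k) !)) (nCk≡n!/k![n-k]! k≤n)) (m/n*n≡m (k![n∸k]!∣n! k≤n))
  where instance _ = k !* (n ∸ k) !≢0

module PowerSeries {c ℓ} (F : CharZeroField c ℓ) where
  open WithField F
  open CharZeroField F using (inverseʳ; charZero)
  open IntegerCoefficientSolver commRing using (solve; _:=_; _:+_; _:*_; _:-_; :-_; ι-+; ι-*)
  open import Relation.Binary.Reasoning.Setoid setoid
  open import Algebra.Properties.Ring ring using (-1*x≈-x; x[y-z]≈xy-xz; -‿+-comm; -0#≈0#)

  1#≉0# : ¬ (1# ≈ 0#)
  1#≉0# 1≈0 = charZero 0 (trans (+-identityʳ 1#) 1≈0)

  x⁻¹*[x*y]≈y : ∀ {x} y → ¬ (x ≈ 0#) → x ⁻¹ * (x * y) ≈ y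
  x⁻¹*[x*y]≈y {x} y x≉0 = begin
    x ⁻¹ * (x * y) ≈⟨ solve 3 (λ x x' y → x' :* (x :* y) := (x :* x') :* y) refl x (x ⁻¹) y ⟩
    (x * x ⁻¹) * y ≈⟨ *-congʳ (inverseʳ x x≉0) ⟩
    1# * y         ≈⟨ *-identityˡ y ⟩
    y              ∎

  x*[y*x⁻¹]≈y : ∀ {x} y → ¬ (x ≈ 0#) → x * (y * x ⁻¹) ≈ y
  x*[y*x⁻¹]≈y {x} y x≉0 = begin
    x * (y * x ⁻¹) ≈⟨ solve 3 (λ x x' y → x :* (y :* x') := y :* (x :* x')) refl x (x ⁻¹) y ⟩
    y * (x * x ⁻¹) ≈⟨ *-congˡ (inverseʳ x x≉0) ⟩
    y * 1#         ≈⟨ *-identityʳ y ⟩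
    y              ∎

  *-nonzero : ∀ {x y} → ¬ (x ≈ 0#) → ¬ (y ≈ 0#) → ¬ (x * y ≈ 0#)
  *-nonzero {x} {y} x≉0 y≉0 xy≈0 = y≉0 (begin
    y              ≈⟨ x⁻¹*[x*y]≈y y x≉0 ⟨
    x ⁻¹ * (x * y) ≈⟨ *-congˡ xy≈0 ⟩
    x ⁻¹ * 0#      ≈⟨ zeroʳ (x ⁻¹) ⟩
    0#             ∎)

  ⁻¹-unique : ∀ {x y} → ¬ (x ≈ 0#) → x * y ≈ 1# → y ≈ x ⁻¹
  ⁻¹-unique {x} {y} x≉0 xy≈1 = begin
    y              ≈⟨ x⁻¹*[x*y]≈y y x≉0 ⟨
    x ⁻¹ * (x * y) ≈⟨ *-congˡ xy≈1 ⟩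
    x ⁻¹ * 1#      ≈⟨ *-identityʳ (x ⁻¹) ⟩
    x ⁻¹           ∎

  ⁻¹-nonzero : ∀ {x} → ¬ (x ≈ 0#) → ¬ (x ⁻¹ ≈ 0#)
  ⁻¹-nonzero {x} x≉0 x⁻¹≈0 =
    1#≉0# (trans (sym (inverseʳ x x≉0)) (trans (*-congˡ x⁻¹≈0) (zeroʳ x)))

  ⁻¹-distrib-* : ∀ {x y} → ¬ (x ≈ 0#) → ¬ (y ≈ 0#) → (x * y) ⁻¹ ≈ x ⁻¹ * y ⁻¹
  ⁻¹-distrib-* {x} {y} x≉0 y≉0 = sym (⁻¹-unique (*-nonzero x≉0 y≉0) (begin
    (x * y) * (x ⁻¹ * y ⁻¹)
      ≈⟨ solve 4 (λ x y x' y' → (x :* y) :* (x' :* y') := (x :* x') :* (y :* y'))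
               refl x y (x ⁻¹) (y ⁻¹) ⟩
    (x * x ⁻¹) * (y * y ⁻¹) ≈⟨ *-cong (inverseʳ x x≉0) (inverseʳ y y≉0) ⟩
    1# * 1#                 ≈⟨ *-identityʳ 1# ⟩
    1#                      ∎))

  ι1⁻¹≈1# : ιF 1 ⁻¹ ≈ 1#
  ι1⁻¹≈1# = sym (⁻¹-unique (charZero 0) (trans (*-identityʳ (ιF 1)) (+-identityʳ 1#)))

  ι-nonzero : ∀ m → .{{ℕ.NonZero m}} → ¬ (ιF m ≈ 0#)
  ι-nonzero (suc m) = charZero m

  !≉0# : ∀ m → ¬ (ιF (m !) ≈ 0#)
  !≉0# m = ι-nonzero (m !) {{m !≢0}}

  pow-nonzero : ∀ {x} → ¬ (x ≈ 0#) → ∀ k → ¬ (pow x k ≈ 0#)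
  pow-nonzero x≉0 zero = 1#≉0#
  pow-nonzero x≉0 (suc k) = *-nonzero (pow-nonzero x≉0 k) x≉0

  powℤ-nonzero : ∀ {x} → ¬ (x ≈ 0#) → ∀ p → ¬ (powℤ x p ≈ 0#)
  powℤ-nonzero x≉0 (+ k) = pow-nonzero x≉0 k
  powℤ-nonzero x≉0 -[1+ k ] = ⁻¹-nonzero (pow-nonzero x≉0 (suc k))

  sumTo-cong : ∀ n {f g : ℕ → Carrier} → (∀ i → i ≤ n → f i ≈ g i) → sumTo n f ≈ sumTo n g
  sumTo-cong zero f≈g = f≈g 0 z≤n
  sumTo-cong (suc n) f≈g =
    +-cong (sumTo-cong n (λ i i≤n → f≈g i (ℕₚ.m≤n⇒m≤1+n i≤n))) (f≈g (suc n) ℕₚ.≤-refl)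

  sumTo-zero : ∀ n {f : ℕ → Carrier} → (∀ i → i ≤ n → f i ≈ 0#) → sumTo n f ≈ 0#
  sumTo-zero n {f} f≈0 = trans (sumTo-cong n f≈0) (sumTo-const-0# n)
    where
    sumTo-const-0# : ∀ n → sumTo n (λ _ → 0#) ≈ 0#
    sumTo-const-0# zero = refl
    sumTo-const-0# (suc n) = trans (+-identityʳ _) (sumTo-const-0# n)

  sumTo-distrib-+ : ∀ n (f g : ℕ → Carrier) →
    sumTo n (λ i → f i + g i) ≈ sumTo n f + sumTo n g
  sumTo-distrib-+ zero f g = refl
  sumTo-distrib-+ (suc n) f g = trans (+-congʳ (sumTo-distrib-+ n f g))
    (solve 4 (λ a b c d → (a :+ b) :+ (c :+ d) := (a :+ c) :+ (b :+ d)) refl _ _ _ _)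

  sumTo-distrib-sub : ∀ n (f g : ℕ → Carrier) →
    sumTo n (λ i → f i - g i) ≈ sumTo n f - sumTo n g
  sumTo-distrib-sub n f g = trans (sumTo-distrib-+ n f (λ i → - g i)) (+-congˡ (sumTo-neg n))
    where
    sumTo-neg : ∀ n → sumTo n (λ i → - g i) ≈ - sumTo n g
    sumTo-neg zero = refl
    sumTo-neg (suc n) = trans (+-congʳ (sumTo-neg n)) (-‿+-comm _ _)

  *-distribˡ-sumTo : ∀ n x (f : ℕ → Carrier) → x * sumTo n f ≈ sumTo n (λ i → x * f i)
  *-distribˡ-sumTo zero x f = refl
  *-distribˡ-sumTo (suc n) x f = trans (distribˡ x _ _) (+-congʳ (*-distribˡ-sumTo n x f))

  *-distribʳ-sumTo : ∀ n x (f : ℕ → Carrier) → sumTo n f * x ≈ sumTo n (λ i → f i * x)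
  *-distribʳ-sumTo n x f = trans (*-comm _ x)
    (trans (*-distribˡ-sumTo n x f) (sumTo-cong n (λ i _ → *-comm x (f i))))

  sumTo-suc : ∀ n (f : ℕ → Carrier) → sumTo (suc n) f ≈ f 0 + sumTo n (λ i → f (suc i))
  sumTo-suc zero f = refl
  sumTo-suc (suc n) f = trans (+-congʳ (sumTo-suc n f)) (+-assoc _ _ _)

  sumTo-comm : ∀ m n (f : ℕ → ℕ → Carrier) →
    sumTo m (λ i → sumTo n (λ j → f i j)) ≈ sumTo n (λ j → sumTo m (λ i → f i j))
  sumTo-comm zero n f = refl
  sumTo-comm (suc m) n f = trans (+-congʳ (sumTo-comm m n f))
    (sym (sumTo-distrib-+ n (λ j → sumTo m (λ i → f i j)) (f (suc m))))

  sumTo-extend : ∀ m d {f : ℕ → Carrier} → (∀ i → m < i → f i ≈ 0#) →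
    sumTo (m ℕ.+ d) f ≈ sumTo m f
  sumTo-extend m zero f≈0 rewrite ℕₚ.+-identityʳ m = refl
  sumTo-extend m (suc d) f≈0 rewrite ℕₚ.+-suc m d =
    trans (+-cong (sumTo-extend m d f≈0) (f≈0 (suc (m ℕ.+ d)) (s≤s (ℕₚ.m≤m+n m d))))
          (+-identityʳ _)

  sumTo-pascal : ∀ m (u : ℕ → Carrier) →
    sumTo (suc m) (λ l → ιF (suc m C l) * u l) ≈ sumTo m (λ l → ιF (m C l) * (u l + u (suc l)))
  sumTo-pascal m u = begin
    sumTo (suc m) (λ l → ιF (suc m C l) * u l)
      ≈⟨ sumTo-suc m _ ⟩
    u₀ + sumTo m (λ l → ιF (suc m C suc l) * u (suc l))
      ≈⟨ +-congˡ (sumTo-cong m (λ l _ → trans (*-congʳ (pascal l)) (distribʳ _ _ _))) ⟩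
    u₀ + sumTo m (λ l → ιF (m C l) * u (suc l) + ιF (m C suc l) * u (suc l))
      ≈⟨ +-congˡ (sumTo-distrib-+ m _ _) ⟩
    u₀ + (shifted + unshifted)
      ≈⟨ solve 3 (λ x a b → x :+ (a :+ b) := (x :+ b) :+ a) refl u₀ shifted unshifted ⟩
    (u₀ + unshifted) + shifted
      ≈⟨ +-congʳ (sym (sumTo-suc m (λ l → ιF (m C l) * u l))) ⟩
    sumTo m (λ l → ιF (m C l) * u l) + ιF (m C suc m) * u (suc m) + shifted
      ≈⟨ +-congʳ (+-congˡ (trans (*-congʳ (reflexive (≡.cong ιF (k>n⇒nCk≡0 (ℕₚ.n<1+n m))))) (zeroˡ _))) ⟩
    sumTo m (λ l → ιF (m C l) * u l) + 0# + shifted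
      ≈⟨ +-congʳ (+-identityʳ _) ⟩
    sumTo m (λ l → ιF (m C l) * u l) + shifted
      ≈⟨ sym (sumTo-distrib-+ m _ _) ⟩
    sumTo m (λ l → ιF (m C l) * u l + ιF (m C l) * u (suc l))
      ≈⟨ sumTo-cong m (λ l _ → sym (distribˡ _ _ _)) ⟩
    sumTo m (λ l → ιF (m C l) * (u l + u (suc l))) ∎
    where
    u₀ = ιF (m C 0) * u 0
    shifted = sumTo m (λ l → ιF (m C l) * u (suc l))
    unshifted = sumTo m (λ l → ιF (m C suc l) * u (suc l))
    pascal : ∀ l → ιF (suc m C suc l) ≈ ιF (m C l) + ιF (m C suc l)
    pascal l = trans (reflexive (≡.cong ιF (≡.sym (nCk+nC[k+1]≡[n+1]C[k+1] m l)))) (ι-+ (m C l) (m C suc l))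

  fall-cong : ∀ {x y} μ k → x ≈ y → fall x μ k ≈ fall y μ k
  fall-cong μ zero x≈y = refl
  fall-cong μ (suc k) x≈y = *-cong (fall-cong μ k x≈y) (+-congʳ x≈y)

  fall-0#-suc : ∀ μ k → fall 0# μ (suc k) ≈ 0#
  fall-0#-suc μ zero = trans (*-identityˡ _) (trans (+-congˡ (trans (-‿cong (zeroˡ μ)) -0#≈0#)) (+-identityʳ 0#))
  fall-0#-suc μ (suc k) = trans (*-congʳ (fall-0#-suc μ k)) (zeroˡ _)

  fall-reflect : ∀ x μ k → pow (- 1#) k * fall x μ k ≈ fall (- x) (- μ) k
  fall-reflect x μ zero = *-identityˡ 1#
  fall-reflect x μ (suc k) = begin
    (pow (- 1#) k * - 1#) * (fall x μ k * (x - ιF k * μ))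
      ≈⟨ solve 4 (λ p m f z → (p :* m) :* (f :* z) := (p :* f) :* (m :* z)) refl _ _ _ _ ⟩
    (pow (- 1#) k * fall x μ k) * (- 1# * (x - ιF k * μ))
      ≈⟨ *-cong (fall-reflect x μ k) (-1*x≈-x _) ⟩
    fall (- x) (- μ) k * - (x - ιF k * μ)
      ≈⟨ *-congˡ (solve 3 (λ x c m → :- (x :- c :* m) := :- x :- c :* (:- m)) refl x (ιF k) μ) ⟩
    fall (- x) (- μ) k * (- x - ιF k * - μ) ∎

  fall-+ : ∀ μ x y n →
    fall (x + y) μ n ≈ sumTo n (λ i → ιF (n C i) * (fall x μ i * fall y μ (n ∸ i)))
  fall-+ μ x y zero = sym (trans (*-congˡ (*-identityʳ 1#)) (trans (*-congʳ (+-identityʳ 1#)) (*-identityʳ 1#)))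
  fall-+ μ x y (suc n) = sym (begin
    sumTo (suc n) (λ i → ιF (suc n C i) * u i)
      ≈⟨ sumTo-pascal n u ⟩
    sumTo n (λ i → ιF (n C i) * (u i + u (suc i)))
      ≈⟨ sumTo-cong n (λ i i≤n → trans (*-congˡ (u-step i i≤n)) (sym (*-assoc _ _ _))) ⟩
    sumTo n (λ i → (ιF (n C i) * (fall x μ i * fall y μ (n ∸ i))) * factor)
      ≈⟨ sym (*-distribʳ-sumTo n factor _) ⟩
    sumTo n (λ i → ιF (n C i) * (fall x μ i * fall y μ (n ∸ i))) * factor
      ≈⟨ *-congʳ (sym (fall-+ μ x y n)) ⟩
    fall (x + y) μ n * factor ∎)
    where
    u : ℕ → Carrier
    u i = fall x μ i * fall y μ (suc n ∸ i)
    factor = (x + y) - ιF n * μ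
    u-step : ∀ i → i ≤ n → u i + u (suc i) ≈ (fall x μ i * fall y μ (n ∸ i)) * factor
    u-step i i≤n = begin
      fall x μ i * fall y μ (suc n ∸ i) + (fall x μ i * (x - ιF i * μ)) * fall y μ (n ∸ i)
        ≈⟨ +-congʳ (*-congˡ (reflexive (≡.cong (fall y μ) (ℕₚ.+-∸-assoc 1 i≤n)))) ⟩
      fall x μ i * (fall y μ (n ∸ i) * (y - ιF (n ∸ i) * μ)) + (fall x μ i * (x - ιF i * μ)) * fall y μ (n ∸ i)
        ≈⟨ solve 7 (λ X Y x y A B m → X :* (Y :* (y :- B :* m)) :+ (X :* (x :- A :* m)) :* Y
                                      := (X :* Y) :* ((x :+ y) :- (B :+ A) :* m)) refl
                   (fall x μ i) (fall y μ (n ∸ i)) x y (ιF i) (ιF (n ∸ i)) μ ⟩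
      (fall x μ i * fall y μ (n ∸ i)) * ((x + y) - (ιF (n ∸ i) + ιF i) * μ)
        ≈⟨ *-congˡ (+-congˡ (-‿cong (*-congʳ (trans (sym (ι-+ (n ∸ i) i)) (reflexive (≡.cong ιF (ℕₚ.m∸n+n≡m i≤n))))))) ⟩
      (fall x μ i * fall y μ (n ∸ i)) * factor ∎

  mulS-cong : ∀ n {f f′ g g′ : Series} → (∀ i → i ≤ n → f i ≈ f′ i) → (∀ i → g i ≈ g′ i) →
    mulS f g n ≈ mulS f′ g′ n
  mulS-cong n f≈f′ g≈g′ = sumTo-cong n (λ i i≤n → *-cong (f≈f′ i i≤n) (g≈g′ _))

  mulS-distribˡ-sub : ∀ (f g h : Series) n → mulS f (λ k → g k - h k) n ≈ mulS f g n - mulS f h n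
  mulS-distribˡ-sub f g h n =
    trans (sumTo-cong n (λ i _ → x[y-z]≈xy-xz (f i) (g (n ∸ i)) (h (n ∸ i)))) (sumTo-distrib-sub n _ _)

  mulS-sumToˡ : ∀ m (a : ℕ → Carrier) (G : ℕ → Series) (g : Series) n →
    mulS (λ i → sumTo m (λ l → a l * G l i)) g n ≈ sumTo m (λ l → a l * mulS (G l) g n)
  mulS-sumToˡ m a G g n = begin
    sumTo n (λ i → sumTo m (λ l → a l * G l i) * g (n ∸ i))
      ≈⟨ sumTo-cong n (λ i _ → *-distribʳ-sumTo m (g (n ∸ i)) _) ⟩
    sumTo n (λ i → sumTo m (λ l → (a l * G l i) * g (n ∸ i)))
      ≈⟨ sumTo-comm n m _ ⟩
    sumTo m (λ l → sumTo n (λ i → (a l * G l i) * g (n ∸ i)))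
      ≈⟨ sumTo-cong m (λ l _ → trans (sumTo-cong n (λ i _ → *-assoc _ _ _)) (sym (*-distribˡ-sumTo n (a l) _))) ⟩
    sumTo m (λ l → a l * mulS (G l) g n) ∎

  powS-vanishes : ∀ g → g 0 ≈ 0# → ∀ m i → i < m → powS g m i ≈ 0#
  powS-vanishes g g₀≈0 (suc m) i i<1+m = sumTo-zero i term-vanishes
    where
    term-vanishes : ∀ j → j ≤ i → powS g m j * g (i ∸ j) ≈ 0#
    term-vanishes j j≤i with j ℕ.<? m
    ... | yes j<m = trans (*-congʳ (powS-vanishes g g₀≈0 m j j<m)) (zeroˡ _)
    ... | no j≮m = trans (*-congˡ (trans (reflexive (≡.cong g i∸j≡0)) g₀≈0)) (zeroʳ _)
      where
      i∸j≡0 : i ∸ j ≡ 0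
      i∸j≡0 = ℕₚ.m≤n⇒m∸n≡0 (ℕₚ.≤-trans (ℕₚ.≤-pred i<1+m) (ℕₚ.≮⇒≥ j≮m))

  compS-truncate : ∀ f g → g 0 ≈ 0# → ∀ {i} n → i ≤ n →
    compS f g i ≈ sumTo n (λ m → f m * powS g m i)
  compS-truncate f g g₀≈0 {i} n i≤n = sym (begin
    sumTo n (λ m → f m * powS g m i)
      ≡⟨ ≡.cong (λ k → sumTo k (λ m → f m * powS g m i)) (ℕₚ.m+[n∸m]≡n i≤n) ⟨
    sumTo (i ℕ.+ (n ∸ i)) (λ m → f m * powS g m i)
      ≈⟨ sumTo-extend i (n ∸ i) (λ m i<m → trans (*-congˡ (powS-vanishes g g₀≈0 m i i<m)) (zeroʳ _)) ⟩
    compS f g i ∎)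

  C≈!-ratio : ∀ {n i} → i ≤ n → ιF (n C i) * ιF (n !) ⁻¹ ≈ ιF (i !) ⁻¹ * ιF ((n ∸ i) !) ⁻¹
  C≈!-ratio {n} {i} i≤n = trans (⁻¹-unique (*-nonzero (!≉0# i) (!≉0# (n ∸ i))) (begin
    (ιF (i !) * ιF ((n ∸ i) !)) * (ιF (n C i) * ιF (n !) ⁻¹)
      ≈⟨ solve 3 (λ d c w → d :* (c :* w) := (c :* d) :* w) refl _ (ιF (n C i)) (ιF (n !) ⁻¹) ⟩
    (ιF (n C i) * (ιF (i !) * ιF ((n ∸ i) !))) * ιF (n !) ⁻¹
      ≈⟨ *-congʳ n!≈C*[i!*[n∸i]!] ⟨
    ιF (n !) * ιF (n !) ⁻¹
      ≈⟨ inverseʳ _ (!≉0# n) ⟩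
    1# ∎)) (⁻¹-distrib-* (!≉0# i) (!≉0# (n ∸ i)))
    where
    n!≈C*[i!*[n∸i]!] : ιF (n !) ≈ ιF (n C i) * (ιF (i !) * ιF ((n ∸ i) !))
    n!≈C*[i!*[n∸i]!] = begin
      ιF (n !)                                      ≡⟨ ≡.cong ιF (nCk*[k!*[n∸k]!]≡n! i≤n) ⟨
      ιF ((n C i) ℕ.* (i ! ℕ.* (n ∸ i) !))          ≈⟨ ι-* (n C i) _ ⟩
      ιF (n C i) * ιF (i ! ℕ.* (n ∸ i) !)           ≈⟨ *-congˡ (ι-* (i !) ((n ∸ i) !)) ⟩
      ιF (n C i) * (ιF (i !) * ιF ((n ∸ i) !))      ∎

  eS-cong : ∀ μ {x y} k → x ≈ y → eS μ x k ≈ eS μ y k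
  eS-cong μ k x≈y = *-congʳ (fall-cong μ k x≈y)

  eS-at-0 : ∀ μ x → eS μ x 0 ≈ 1#
  eS-at-0 μ x = trans (*-identityˡ _) ι1⁻¹≈1#

  eS-0#-suc : ∀ μ k → eS μ 0# (suc k) ≈ 0#
  eS-0#-suc μ k = trans (*-congʳ (fall-0#-suc μ k)) (zeroˡ _)

  negArg-eS : ∀ μ x k → negArg (eS μ x) k ≈ eS (- μ) (- x) k
  negArg-eS μ x k = trans (sym (*-assoc _ _ _)) (*-congʳ (fall-reflect x μ k))

  eS-mulS : ∀ μ x y n → mulS (eS μ x) (eS μ y) n ≈ eS μ (x + y) n
  eS-mulS μ x y n = sym (begin
    fall (x + y) μ n * ιF (n !) ⁻¹
      ≈⟨ *-congʳ (fall-+ μ x y n) ⟩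
    sumTo n (λ i → ιF (n C i) * (fall x μ i * fall y μ (n ∸ i))) * ιF (n !) ⁻¹
      ≈⟨ *-distribʳ-sumTo n _ _ ⟩
    sumTo n (λ i → (ιF (n C i) * (fall x μ i * fall y μ (n ∸ i))) * ιF (n !) ⁻¹)
      ≈⟨ sumTo-cong n term ⟩
    mulS (eS μ x) (eS μ y) n ∎)
    where
    term : ∀ i → i ≤ n → (ιF (n C i) * (fall x μ i * fall y μ (n ∸ i))) * ιF (n !) ⁻¹
                         ≈ eS μ x i * eS μ y (n ∸ i)
    term i i≤n = begin
      (ιF (n C i) * (fall x μ i * fall y μ (n ∸ i))) * ιF (n !) ⁻¹
        ≈⟨ solve 4 (λ c a b w → (c :* (a :* b)) :* w := (a :* b) :* (c :* w)) refl _ _ _ _ ⟩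
      (fall x μ i * fall y μ (n ∸ i)) * (ιF (n C i) * ιF (n !) ⁻¹)
        ≈⟨ *-congˡ (C≈!-ratio i≤n) ⟩
      (fall x μ i * fall y μ (n ∸ i)) * (ιF (i !) ⁻¹ * ιF ((n ∸ i) !) ⁻¹)
        ≈⟨ solve 4 (λ a b p q → (a :* b) :* (p :* q) := (a :* p) :* (b :* q)) refl _ _ _ _ ⟩
      eS μ x i * eS μ y (n ∸ i) ∎

  module _ (lam : Carrier) where
    private
      μ = - lam
      E = eS μ
      y = yS lam

    yS-0 : yS lam 0 ≈ 0#
    yS-0 = trans (+-congˡ (-‿cong (trans (*-identityˡ _) (eS-at-0 lam 1#)))) (-‿inverseʳ 1#)

    yS-eS : ∀ k → yS lam k ≈ E 0# k - E (- 1#) k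
    yS-eS zero = trans yS-0 (sym (trans (+-cong (eS-at-0 μ 0#) (-‿cong (eS-at-0 μ (- 1#)))) (-‿inverseʳ 1#)))
    yS-eS (suc k) = begin
      - negArg (eS lam 1#) (suc k)      ≈⟨ -‿cong (negArg-eS lam 1# (suc k)) ⟩
      - E (- 1#) (suc k)                ≈⟨ +-identityˡ _ ⟨
      0# - E (- 1#) (suc k)             ≈⟨ +-congʳ (eS-0#-suc μ k) ⟨
      E 0# (suc k) - E (- 1#) (suc k)   ∎

    mulS-eS-yS : ∀ x n → mulS (E x) y n ≈ E x n - E (x - 1#) n
    mulS-eS-yS x n = begin
      mulS (E x) y n
        ≈⟨ mulS-cong n (λ _ _ → refl) yS-eS ⟩
      mulS (E x) (λ k → E 0# k - E (- 1#) k) n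
        ≈⟨ mulS-distribˡ-sub (E x) (E 0#) (E (- 1#)) n ⟩
      mulS (E x) (E 0#) n - mulS (E x) (E (- 1#)) n
        ≈⟨ +-cong (trans (eS-mulS μ x 0# n) (eS-cong μ n (+-identityʳ x))) (-‿cong (eS-mulS μ x (- 1#) n)) ⟩
      E x n - E (x - 1#) n ∎

    powS-yS : ∀ m n → powS y m n ≈ sumTo m (λ l → ιF (m C l) * pow (- 1#) l * E (- ιF l) n)
    powS-yS zero zero = sym (trans (*-cong (trans (*-identityʳ _) (+-identityʳ 1#)) (eS-at-0 μ (- ιF 0))) (*-identityʳ 1#))
    powS-yS zero (suc n) = sym (trans (*-congˡ (trans (eS-cong μ (suc n) -0#≈0#) (eS-0#-suc μ n))) (zeroʳ _))
    powS-yS (suc m) n = begin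
      mulS (powS y m) y n
        ≈⟨ mulS-cong n {g = y} (λ i _ → powS-yS m i) (λ _ → refl) ⟩
      mulS (λ i → sumTo m (λ l → ιF (m C l) * pow (- 1#) l * E (- ιF l) i)) y n
        ≈⟨ mulS-sumToˡ m (λ l → ιF (m C l) * pow (- 1#) l) (λ l → E (- ιF l)) y n ⟩
      sumTo m (λ l → ιF (m C l) * pow (- 1#) l * mulS (E (- ιF l)) y n)
        ≈⟨ sumTo-cong m (λ l _ → trans (*-congˡ (mulS-eS-yS (- ιF l) n)) (*-assoc _ _ _)) ⟩
      sumTo m (λ l → ιF (m C l) * (pow (- 1#) l * (h l - E (- ιF l - 1#) n)))
        ≈⟨ sumTo-cong m (λ l _ → *-congˡ (sym (alternating l))) ⟩
      sumTo m (λ l → ιF (m C l) * (u l + u (suc l)))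
        ≈⟨ sumTo-pascal m u ⟨
      sumTo (suc m) (λ l → ιF (suc m C l) * u l)
        ≈⟨ sumTo-cong (suc m) (λ l _ → sym (*-assoc _ _ _)) ⟩
      sumTo (suc m) (λ l → ιF (suc m C l) * pow (- 1#) l * E (- ιF l) n) ∎
      where
      h : ℕ → Carrier
      h l = E (- ιF l) n
      u : ℕ → Carrier
      u l = pow (- 1#) l * h l
      alternating : ∀ l → u l + u (suc l) ≈ pow (- 1#) l * (h l - E (- ιF l - 1#) n)
      alternating l = begin
        pow (- 1#) l * h l + (pow (- 1#) l * - 1#) * h (suc l)
          ≈⟨ solve 4 (λ s m a b → s :* a :+ (s :* m) :* b := s :* (a :+ m :* b)) refl _ (- 1#) _ _ ⟩
        pow (- 1#) l * (h l + - 1# * h (suc l))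
          ≈⟨ *-congˡ (+-congˡ (-1*x≈-x _)) ⟩
        pow (- 1#) l * (h l - h (suc l))
          ≈⟨ *-congˡ (+-congˡ (-‿cong (eS-cong μ n (solve 2 (λ o x → :- (o :+ x) := (:- x) :- o) refl 1# (ιF l))))) ⟩
        pow (- 1#) l * (h l - E (- ιF l - 1#) n) ∎

    mulS-powS-yS-eS : ∀ m x n → mulS (powS y m) (E x) n ≈
      sumTo m (λ l → ιF (m C l) * pow (- 1#) l * fall (x - ιF l) μ n) * ιF (n !) ⁻¹
    mulS-powS-yS-eS m x n = begin
      mulS (powS y m) (E x) n
        ≈⟨ mulS-cong n {g = E x} (λ i _ → powS-yS m i) (λ _ → refl) ⟩
      mulS (λ i → sumTo m (λ l → ιF (m C l) * pow (- 1#) l * E (- ιF l) i)) (E x) n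
        ≈⟨ mulS-sumToˡ m (λ l → ιF (m C l) * pow (- 1#) l) (λ l → E (- ιF l)) (E x) n ⟩
      sumTo m (λ l → ιF (m C l) * pow (- 1#) l * mulS (E (- ιF l)) (E x) n)
        ≈⟨ sumTo-cong m (λ l _ → *-congˡ (trans (eS-mulS μ (- ιF l) x n) (eS-cong μ n (+-comm _ x)))) ⟩
      sumTo m (λ l → ιF (m C l) * pow (- 1#) l * (fall (x - ιF l) μ n * ιF (n !) ⁻¹))
        ≈⟨ sumTo-cong m (λ l _ → sym (*-assoc _ _ _)) ⟩
      sumTo m (λ l → ιF (m C l) * pow (- 1#) l * fall (x - ιF l) μ n * ιF (n !) ⁻¹)
        ≈⟨ *-distribʳ-sumTo m _ _ ⟨
      sumTo m (λ l → ιF (m C l) * pow (- 1#) l * fall (x - ιF l) μ n) * ιF (n !) ⁻¹ ∎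

  liOverY-coefficient : ∀ p lam j → liOverY p lam j ≈
    (pow (- lam) j * fall 1# (lam ⁻¹) (suc j)) * ((powℤ (ιF (suc j)) p * ιF (j !)) ⁻¹)
  liOverY-coefficient p lam j = sym (trans
    (*-congˡ (⁻¹-distrib-* (powℤ-nonzero (charZero j) p) (!≉0# j)))
    (solve 3 (λ a q b → a :* (q :* b) := (a :* b) :* q) refl _ _ _))

theorem8 : ∀ {c ℓ} (F : CharZeroField c ℓ) → let open WithField F in
    (lam : Carrier) → ¬ (lam ≈ 0#) → (p : ℤ) (n : ℕ) (x : Carrier) →
    β p n lam x ≈ theorem8-rhs p n lam x
theorem8 F lam _ p n x = begin
  n! * mulS (compS (liOverY p lam) y) (negArg (eS lam (- x))) n
    ≈⟨ *-congˡ (mulS-cong n (λ i i≤n → compS-truncate (liOverY p lam) y (yS-0 lam) n i≤n) negArg-eS-x) ⟩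
  n! * mulS (λ i → sumTo n (λ m → liOverY p lam m * powS y m i)) (eS μ x) n
    ≈⟨ *-congˡ (mulS-sumToˡ n (liOverY p lam) (powS y) (eS μ x) n) ⟩
  n! * sumTo n (λ m → liOverY p lam m * mulS (powS y m) (eS μ x) n)
    ≈⟨ *-congˡ (sumTo-cong n (λ m _ → *-congˡ (mulS-powS-yS-eS lam m x n))) ⟩
  n! * sumTo n (λ m → liOverY p lam m * (S m * n! ⁻¹))
    ≈⟨ *-congˡ (sumTo-cong n (λ m _ → sym (*-assoc _ _ _))) ⟩
  n! * sumTo n (λ m → liOverY p lam m * S m * n! ⁻¹)
    ≈⟨ *-congˡ (*-distribʳ-sumTo n _ _) ⟨
  n! * (sumTo n (λ m → liOverY p lam m * S m) * n! ⁻¹)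
    ≈⟨ x*[y*x⁻¹]≈y _ (!≉0# n) ⟩
  sumTo n (λ m → liOverY p lam m * S m)
    ≈⟨ sumTo-cong n (λ m _ → *-congʳ (liOverY-coefficient p lam m)) ⟩
  theorem8-rhs p n lam x ∎
  where
  open WithField F
  open PowerSeries F
  open import Relation.Binary.Reasoning.Setoid setoid
  open import Algebra.Properties.Ring ring using (-‿involutive)
  μ = - lam
  y = yS lam
  n! = ιF (n !)
  S : ℕ → Carrier
  S m = sumTo m (λ l → ιF (m C l) * pow (- 1#) l * fall (x - ιF l) μ n)
  negArg-eS-x : ∀ k → negArg (eS lam (- x)) k ≈ eS μ x k
  negArg-eS-x k = trans (negArg-eS lam (- x) k) (eS-cong μ k (-‿involutive x))
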